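{- For every $k\in\mathbb{N}$ there exist hypergraphs $G$ and $H$ such that $b(G)-b_L(G)>k$ and $\frac{b(H)}{b_L(H)}>k$.
   Context: A hypergraph $H$ consists of a nonempty finite vertex set $V(H)$ and a finite family $E(H)$ of edges, each a subset of $V(H)$. Round-based burning: let $F_0=\emptyset$. In each round $r=1,2,\ldots$ simultaneously: every vertex $v\notin F_{r-1}$ for which there is an edge $e$ with $|e|\geq 2$, $v\in e$ and $e\setminus\{v\}\subseteq F_{r-1}$ catches fire; and a chosen vertex $u_r\notin F_{r-1}$ (a source) is set on fire. $F_r$ is $F_{r-1}$ together with all vertices set on fire in round $r$. A sequence $(u_1,\ldots,u_k)$ with $u_r\notin F_{r-1}$ for all $r$ and $F_k=V(H)$ is a burning sequence; $b(H)$ is the minimum length of a burning sequence. Lazy burning: a set $S\subseteq V(H)$ is set on fire; then repeatedly any unburned vertex $v$ lying in an edge $e$ with $|e|\geq 2$ such that all vertices of $e\setminus\{v\}$ are on fire catches fire; $S$ is a lazy burning set if eventually all vertices are on fire; $b_L(H)$ is the minimum size of a lazy burning set. -}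

module Defs where

open import Data.Nat using (ℕ; zero; suc; _≤_; _<_)
open import Data.Fin using (Fin)
open import Data.Fin.Subset using (Subset; _∈_; ∣_∣)
open import Data.List using (List)
import Data.List.Membership.Propositional as L
open import Data.Product using (Σ; ∃; _×_)
open import Data.Sum using (_⊎_)
open import Data.Empty using (⊥)
open import Relation.Nullary using (¬_)
open import Relation.Binary.PropositionalEquality using (_≡_; _≢_)

record Hypergraph : Set where
  field
    n        : ℕ
    nonempty : 1 ≤ n
    edges    : List (Subset n)
open Hypergraph public

module _ (H : Hypergraph) where
  private
    V = Fin (n H)

  Catches : (V → Set) → V → Set
  Catches F v = Σ (Subset (n H)) λ e →
    e L.∈ edges H × 2 ≤ ∣ e ∣ × v ∈ e × (∀ w → w ∈ e → w ≢ v → F w)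

  -- Round-based burning with sources u 0, u 1, ... (u r is the source of
  -- round r+1).  Burned u r is the fire set F_r.
  Burned : (ℕ → V) → ℕ → V → Set
  Burned u zero    v = ⊥
  Burned u (suc r) v = Burned u r v ⊎ Catches (Burned u r) v ⊎ v ≡ u r

  IsBurningSeq : ℕ → (ℕ → V) → Set
  IsBurningSeq k u = (∀ r → r < k → ¬ Burned u r (u r)) × (∀ v → Burned u k v)

  IsBurningNumber : ℕ → Set
  IsBurningNumber m =
    (∃ λ u → IsBurningSeq m u) × (∀ k u → IsBurningSeq k u → m ≤ k)

  data LazyBurned (S : Subset (n H)) : V → Set where
    source : ∀ {v} → v ∈ S → LazyBurned S v
    spread : ∀ {v} → Catches (LazyBurned S) v → LazyBurned S v

  IsLazyBurningSet : Subset (n H) → Set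
  IsLazyBurningSet S = ∀ v → LazyBurned S v

  IsLazyBurningNumber : ℕ → Set
  IsLazyBurningNumber m =
    (∃ λ S → IsLazyBurningSet S × ∣ S ∣ ≡ m)
    × (∀ S → IsLazyBurningSet S → m ≤ ∣ S ∣)

-- Take vertices 0, …, 2m with the initial segments {0, …, j}, j ≥ 1, as edges.  A nonzero
-- vertex catches fire exactly when all smaller vertices burn, so lazily the vertex 0 alone
-- burns everything (b_L = 1).  In round-based burning each round adds the source and at most
-- the least unburned vertex, so r rounds burn at most 2r vertices, while the sources
-- 0, 2, 4, … burn all 2m + 1 vertices in m + 1 rounds: b = m + 1.
-- Taking m = k + 1 gives b − b_L = k + 1 and b / b_L = k + 2.
module Submission where

open import Defs
open import Data.Nat using (ℕ; zero; suc; _+_; _*_; _≤_; _<_; z≤n; s≤s; s≤s⁻¹; _≤ᵇ_; _≤?_)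
open import Data.Nat.Properties
open import Data.Nat.DivMod using (_mod_; m<n⇒m%n≡m; m%n≤m)
open import Data.Bool.Properties using (T-≡)
open import Data.Fin as Fin using (Fin; toℕ)
import Data.Fin.Properties as Fin
open import Data.Fin.Induction using (<-wellFounded)
open import Data.Fin.Subset using (Subset; Nonempty; _∈_; _⊆_; ⁅_⁆; ∣_∣)
open import Data.Fin.Subset.Properties
  using (_∈?_; x∈⁅x⁆; x∈⁅y⁆⇒x≡y; ∣⁅x⁆∣≡1; p⊆q⇒∣p∣≤∣q∣; x∈p∧x≢y⇒x∈p-y; x∈p⇒∣p-x∣<∣p∣)
open import Data.Vec using (tabulate)
open import Data.Vec.Properties using ([]=⇒lookup; lookup⇒[]=; lookup∘tabulate)
open import Data.List using (List; []; _∷_; map; upTo; length)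
import Data.List as List
import Data.List.Membership.Propositional as List
open import Data.List.Membership.Propositional.Properties using (∈-map⁺; ∈-map⁻; ∈-upTo⁺)
open import Data.List.Relation.Unary.Any using (here; there; index)
open import Data.List.Relation.Unary.Any.Properties using (lookup-index)
open import Data.Product using (Σ; ∃; _×_; _,_)
open import Data.Sum using (inj₁; inj₂)
open import Function using (_∘_)
open import Function.Bundles using (Equivalence)
open import Induction.WellFounded using (Acc; acc)
open import Relation.Nullary using (¬_; yes; no)
open import Relation.Nullary.Decidable using (_×-dec_; ¬?)
open import Relation.Nullary.Negation using (contradiction)
open import Relation.Binary.PropositionalEquality
open import Relation.Binary.Definitions using (tri<; tri≈; tri>)

nonempty⇒1≤∣p∣ : ∀ {n} {p : Subset n} → Nonempty p → 1 ≤ ∣ p ∣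
nonempty⇒1≤∣p∣ {p = p} (x , x∈p) =
  subst (_≤ ∣ p ∣) (∣⁅x⁆∣≡1 x) (p⊆q⇒∣p∣≤∣q∣ λ y∈⁅x⁆ → subst (_∈ p) (sym (x∈⁅y⁆⇒x≡y x y∈⁅x⁆)) x∈p)

two-members⇒2≤∣p∣ : ∀ {n} {p : Subset n} {x y} → x ∈ p → y ∈ p → x ≢ y → 2 ≤ ∣ p ∣
two-members⇒2≤∣p∣ {y = y} x∈p y∈p x≢y =
  ≤-trans (s≤s (nonempty⇒1≤∣p∣ (y , x∈p∧x≢y⇒x∈p-y y∈p (x≢y ∘ sym)))) (x∈p⇒∣p-x∣<∣p∣ x∈p)

2≤∣p∣⇒∃≢ : ∀ {n} {p : Subset n} (x : Fin n) → 2 ≤ ∣ p ∣ → ∃ λ y → y ∈ p × y ≢ x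
2≤∣p∣⇒∃≢ {p = p} x 2≤∣p∣ with Fin.any? (λ y → y ∈? p ×-dec ¬? (y Fin.≟ x))
... | yes found = found
... | no none = contradiction (p⊆q⇒∣p∣≤∣q∣ p⊆⁅x⁆) (<⇒≱ (subst (_< ∣ p ∣) (sym (∣⁅x⁆∣≡1 x)) 2≤∣p∣))
  where
  p⊆⁅x⁆ : p ⊆ ⁅ x ⁆
  p⊆⁅x⁆ {y} y∈p with y Fin.≟ x
  ... | yes refl = x∈⁅x⁆ x
  ... | no y≢x = contradiction (y , y∈p , y≢x) none

enumeration-length : ∀ {n} (L : List (Fin n)) → (∀ i → i List.∈ L) → n ≤ length L
enumeration-length {n} L all with n ≤? length L
... | yes n≤|L| = n≤|L|
... | no n≰|L| with Fin.pigeonhole (≰⇒> n≰|L|) (λ i → index (all i))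
...   | i , j , i<j , same-index = contradiction (cong toℕ i≡j) (<⇒≢ i<j)
  where
  i≡j : i ≡ j
  i≡j = begin
    i                             ≡⟨ lookup-index (all i) ⟩
    List.lookup L (index (all i)) ≡⟨ cong (List.lookup L) same-index ⟩
    List.lookup L (index (all j)) ≡⟨ lookup-index (all j) ⟨
    j                             ∎
    where open ≡-Reasoning

module _ (H : Hypergraph) where
  private
    V = Fin (n H)

  Catches-mono : ∀ {F G : V → Set} {v} → (∀ w → F w → G w) → Catches H F v → Catches H G v
  Catches-mono F⊆G (e , e∈E , 2≤∣e∣ , v∈e , burning) =
    e , e∈E , 2≤∣e∣ , v∈e , λ w w∈e w≢v → F⊆G w (burning w w∈e w≢v)

  LazyBurned⇒nonempty : ∀ {S v} → LazyBurned H S v → Nonempty S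
  LazyBurned⇒nonempty (source v∈S) = _ , v∈S
  LazyBurned⇒nonempty (spread {v} (e , _ , 2≤∣e∣ , _ , burning)) with 2≤∣p∣⇒∃≢ v 2≤∣e∣
  ... | w , w∈e , w≢v = LazyBurned⇒nonempty (burning w w∈e w≢v)

  singleton-lazyBurningNumber : ∀ v → IsLazyBurningSet H ⁅ v ⁆ → IsLazyBurningNumber H 1
  singleton-lazyBurningNumber v burns =
      (⁅ v ⁆ , burns , ∣⁅x⁆∣≡1 v)
    , λ S burnsS → nonempty⇒1≤∣p∣ (LazyBurned⇒nonempty (burnsS v))

  SpreadsOneAtATime : Set
  SpreadsOneAtATime = ∀ (L : List V) → ∃ λ c → ∀ v → Catches H (List._∈ L) v → v List.∈ c ∷ L

  module _ (slow : SpreadsOneAtATime) where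

    burned-covered : ∀ u r → ∃ λ L → length L ≤ 2 * r × (∀ v → Burned H u r v → v List.∈ L)
    burned-covered u zero = [] , z≤n , λ v ()
    burned-covered u (suc r) with burned-covered u r
    ... | L , |L|≤2r , covered with slow L
    ... | c , ignites = u r ∷ c ∷ L , |L'|≤2r' , covered'
      where
      |L'|≤2r' : length (u r ∷ c ∷ L) ≤ 2 * suc r
      |L'|≤2r' = subst (2 + length L ≤_) (sym (*-suc 2 r)) (s≤s (s≤s |L|≤2r))
      covered' : ∀ v → Burned H u (suc r) v → v List.∈ u r ∷ c ∷ L
      covered' v (inj₁ burned) = there (there (covered v burned))
      covered' v (inj₂ (inj₁ catches)) = there (ignites v (Catches-mono covered catches))
      covered' v (inj₂ (inj₂ refl)) = here refl

    burningSeq⇒n≤2k : ∀ {k u} → IsBurningSeq H k u → n H ≤ 2 * k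
    burningSeq⇒n≤2k {k} {u} (_ , all) with burned-covered u k
    ... | L , |L|≤2k , covered = ≤-trans (enumeration-length L λ v → covered v (all v)) |L|≤2k

segment : ∀ {n} → ℕ → Subset n
segment j = tabulate λ v → toℕ v ≤ᵇ j

∈-segment⁺ : ∀ {n j} {v : Fin n} → toℕ v ≤ j → v ∈ segment j
∈-segment⁺ {j = j} {v} v≤j =
  lookup⇒[]= v (segment j) (trans (lookup∘tabulate _ v) (Equivalence.to T-≡ (≤⇒≤ᵇ v≤j)))

∈-segment⁻ : ∀ {n j} {v : Fin n} → v ∈ segment j → toℕ v ≤ j
∈-segment⁻ {j = j} {v} v∈segment =
  ≤ᵇ⇒≤ (toℕ v) j (Equivalence.from T-≡ (trans (sym (lookup∘tabulate _ v)) ([]=⇒lookup v∈segment)))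

prefixHypergraph : ℕ → Hypergraph
prefixHypergraph d = record
  { n = suc d ; nonempty = s≤s z≤n ; edges = map (λ j → segment (suc j)) (upTo d) }

catches⇒below-burning : ∀ {d} {F : Fin (suc d) → Set} {v} →
  Catches (prefixHypergraph d) F v → ∀ w → toℕ w < toℕ v → F w
catches⇒below-burning {d} (e , e∈E , _ , v∈e , burning) w w<v with ∈-map⁻ _ {xs = upTo d} e∈E
... | j , _ , refl =
  burning w (∈-segment⁺ {j = suc j} (≤-trans (<⇒≤ w<v) (∈-segment⁻ v∈e)))
            λ { refl → <-irrefl refl w<v }

below-burning⇒catches : ∀ {d} {F : Fin (suc d) → Set} {v} →
  0 < toℕ v → (∀ w → toℕ w < toℕ v → F w) → Catches (prefixHypergraph d) F v
below-burning⇒catches {suc d} {v = Fin.suc v} _ below =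
  e , ∈-map⁺ _ (∈-upTo⁺ (Fin.toℕ<n v)) , 2≤∣e∣ , ∈-segment⁺ ≤-refl ,
  λ w w∈e w≢v → below w (≤∧≢⇒< (∈-segment⁻ w∈e) (w≢v ∘ Fin.toℕ-injective))
  where
  e : Subset (suc (suc d))
  e = segment (toℕ (Fin.suc v))
  2≤∣e∣ : 2 ≤ ∣ e ∣
  2≤∣e∣ = two-members⇒2≤∣p∣ {p = e} {Fin.zero} {Fin.suc Fin.zero}
            (∈-segment⁺ {j = suc (toℕ v)} z≤n) (∈-segment⁺ {j = suc (toℕ v)} (s≤s z≤n)) (λ ())

prefix-lazyBurningNumber : ∀ {d} → IsLazyBurningNumber (prefixHypergraph d) 1
prefix-lazyBurningNumber {d} =
  singleton-lazyBurningNumber _ Fin.zero λ v → burns v (<-wellFounded v)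
  where
  burns : ∀ v → Acc Fin._<_ v → LazyBurned (prefixHypergraph d) ⁅ Fin.zero ⁆ v
  burns Fin.zero _ = source (x∈⁅x⁆ Fin.zero)
  burns (Fin.suc v) (acc below) =
    spread (below-burning⇒catches (s≤s z≤n) λ w w<v → burns w (below w<v))

module _ {d : ℕ} where
  open import Data.List.Membership.DecPropositional (Fin._≟_ {suc d}) using () renaming (_∈?_ to _∈ₗ?_)

  prefix-spreadsOneAtATime : SpreadsOneAtATime (prefixHypergraph d)
  prefix-spreadsOneAtATime L with Fin.all? (_∈ₗ? L)
  ... | yes all = Fin.zero , λ v _ → there (all v)
  ... | no ¬all with Fin.¬∀⟶∃¬-smallest (suc d) (List._∈ L) (_∈ₗ? L) ¬all
  ... | c , c∉L , below-c∈L = c , ignites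
    where
    below-c : ∀ w → toℕ w < toℕ c → w List.∈ L
    below-c w w<c = subst (List._∈ L) inject≡w (below-c∈L (Fin.fromℕ< w<c))
      where
      inject≡w : Fin.inject (Fin.fromℕ< w<c) ≡ w
      inject≡w = Fin.toℕ-injective (trans (Fin.toℕ-inject _) (Fin.toℕ-fromℕ< w<c))

    -- Both v and c are least vertices outside L.
    ignites : ∀ v → Catches (prefixHypergraph d) (List._∈ L) v → v List.∈ c ∷ L
    ignites v catches with v ∈ₗ? L
    ... | yes v∈L = there v∈L
    ... | no v∉L = here (Fin.toℕ-injective (≤-antisym v≤c c≤v))
      where
      v≤c : toℕ v ≤ toℕ c
      v≤c = ≮⇒≥ λ c<v → c∉L (catches⇒below-burning catches c c<v)
      c≤v : toℕ c ≤ toℕ v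
      c≤v = ≮⇒≥ λ v<c → v∉L (below-c v v<c)

  -- The source of round r + 1 is vertex 2r; the value once 2r > d is irrelevant.
  evenSource : ℕ → Fin (suc d)
  evenSource r = (2 * r) mod (suc d)

  toℕ-evenSource : ∀ r → 2 * r ≤ d → toℕ (evenSource r) ≡ 2 * r
  toℕ-evenSource r 2r≤d = trans (Fin.toℕ-fromℕ< _) (m<n⇒m%n≡m (s≤s 2r≤d))

  toℕ-evenSource≤ : ∀ r → toℕ (evenSource r) ≤ 2 * r
  toℕ-evenSource≤ r = ≤-trans (≤-reflexive (Fin.toℕ-fromℕ< _)) (m%n≤m (2 * r) (suc d))

  toℕ≡2r⇒≡evenSource : ∀ r {v} → toℕ v ≡ 2 * r → v ≡ evenSource r
  toℕ≡2r⇒≡evenSource r {v} v≡2r = Fin.toℕ-injective (trans v≡2r (sym (toℕ-evenSource r 2r≤d)))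
    where
    2r≤d : 2 * r ≤ d
    2r≤d = subst (_≤ d) v≡2r (s≤s⁻¹ (Fin.toℕ<n v))

  evenSource-burned⇒< : ∀ r v → Burned (prefixHypergraph d) evenSource r v → toℕ v < 2 * r
  evenSource-burned⇒< zero v ()
  evenSource-burned⇒< (suc r) v burned = subst (toℕ v <_) (sym (*-suc 2 r)) (grows burned)
    where
    grows : Burned (prefixHypergraph d) evenSource (suc r) v → toℕ v < 2 + 2 * r
    grows (inj₁ burned) = ≤-trans (evenSource-burned⇒< r v burned) (m≤n+m (2 * r) 2)
    grows (inj₂ (inj₂ refl)) = s≤s (m≤n⇒m≤1+n (toℕ-evenSource≤ r))
    grows (inj₂ (inj₁ catches)) with toℕ v ≤? suc (2 * r)
    ... | yes v≤2r+1 = s≤s v≤2r+1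
    ... | no v≰2r+1 =
      contradiction (evenSource-burned⇒< r s s-burned) (<-irrefl (toℕ-evenSource r 2r≤d))
      where
      2r<v : 2 * r < toℕ v
      2r<v = ≤-trans (n≤1+n _) (≰⇒> v≰2r+1)
      2r≤d : 2 * r ≤ d
      2r≤d = <⇒≤ (<-≤-trans 2r<v (s≤s⁻¹ (Fin.toℕ<n v)))
      s = evenSource r
      s-burned : Burned (prefixHypergraph d) evenSource r s
      s-burned = catches⇒below-burning catches s
                   (subst (_< toℕ v) (sym (toℕ-evenSource r 2r≤d)) 2r<v)

  ≤2r⇒evenSource-burned : ∀ r v → toℕ v ≤ 2 * r → Burned (prefixHypergraph d) evenSource (suc r) v
  ≤2r⇒evenSource-burned zero v v≤0 = inj₂ (inj₂ (toℕ≡2r⇒≡evenSource zero (n≤0⇒n≡0 v≤0)))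
  ≤2r⇒evenSource-burned (suc r) v v≤2r+2 with <-cmp (toℕ v) (suc (2 * r))
  ... | tri< v≤2r _ _ = inj₁ (≤2r⇒evenSource-burned r v (s≤s⁻¹ v≤2r))
  ... | tri≈ _ v≡2r+1 _ =
    inj₂ (inj₁ (below-burning⇒catches (subst (0 <_) (sym v≡2r+1) (s≤s z≤n)) below))
    where
    below : ∀ w → toℕ w < toℕ v → Burned (prefixHypergraph d) evenSource (suc r) w
    below w w<v = ≤2r⇒evenSource-burned r w (s≤s⁻¹ (subst (toℕ w <_) v≡2r+1 w<v))
  ... | tri> _ _ 2r+1<v =
    inj₂ (inj₂ (toℕ≡2r⇒≡evenSource (suc r) (≤-antisym v≤2r+2 2r+2≤v)))
    where
    2r+2≤v : 2 * suc r ≤ toℕ v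
    2r+2≤v = subst (_≤ toℕ v) (sym (*-suc 2 r)) 2r+1<v

prefix-burningNumber : ∀ m → IsBurningNumber (prefixHypergraph (2 * m)) (suc m)
prefix-burningNumber m = (evenSource , legal , burnsAll) , minimal
  where
  burnsAll : ∀ v → Burned (prefixHypergraph (2 * m)) evenSource (suc m) v
  burnsAll v = ≤2r⇒evenSource-burned m v (s≤s⁻¹ (Fin.toℕ<n v))
  minimal : ∀ k u → IsBurningSeq (prefixHypergraph (2 * m)) k u → suc m ≤ k
  minimal k u burns = *-cancelˡ-< 2 m k (burningSeq⇒n≤2k _ prefix-spreadsOneAtATime burns)
  legal : ∀ r → r < suc m → ¬ Burned (prefixHypergraph (2 * m)) evenSource r (evenSource r)
  legal r r≤m burned =
    <-irrefl (toℕ-evenSource r (*-monoʳ-≤ 2 (s≤s⁻¹ r≤m))) (evenSource-burned⇒< r _ burned)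

mainTheorem8 : (k : ℕ) →
    (Σ Hypergraph λ G → Σ ℕ λ bG → Σ ℕ λ bLG →
       IsBurningNumber G bG × IsLazyBurningNumber G bLG × bLG + k < bG)
    × (Σ Hypergraph λ H → Σ ℕ λ bH → Σ ℕ λ bLH →
       IsBurningNumber H bH × IsLazyBurningNumber H bLH × 0 < bLH × k * bLH < bH)
mainTheorem8 k =
    (P , 2 + k , 1 , b[P] , bL[P] , ≤-refl)
  , (P , 2 + k , 1 , b[P] , bL[P] , s≤s z≤n , k*1<2+k)
  where
  P : Hypergraph
  P = prefixHypergraph (2 * suc k)
  b[P] : IsBurningNumber P (2 + k)
  b[P] = prefix-burningNumber (suc k)
  bL[P] : IsLazyBurningNumber P 1
  bL[P] = prefix-lazyBurningNumber
  k*1<2+k : k * 1 < 2 + k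
  k*1<2+k = subst (_< 2 + k) (sym (*-identityʳ k)) (m<n+m k (s≤s z≤n))
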